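{- Let $\mathcal{F}$ be a maximal intersecting subfamily of $\mathcal{P}([n])$ that is central, i.e. $2|A| \ge n$ for all $A \in \mathcal{F}$. Then $\mathcal{F}$ is $\emptyset$-minimal.
   Context: $[n] = \{1,\dots,n\}$, $\mathcal{P}([n])$ is the power set, $\oplus$ is symmetric difference, complements are in $[n]$. A family is intersecting if any two members intersect; a maximal intersecting subfamily of $\mathcal{P}([n])$ is one not properly contained in another intersecting subfamily. $\mathcal{F}^* = \{A^c : A \in \mathcal{F}\}$. Let $\Sigma$ be the set of permutations of $[n]$; for $\sigma \in \Sigma$, $X \subseteq [n]$ let $P^{\sigma,X}_0 = X$, $P^{\sigma,X}_k = P^{\sigma,X}_{k-1} \oplus \{\sigma(k)\}$ ($k \in [n]$). For a family $\mathcal{G}$ define $\Lambda(\mathcal{G}) \in \mathbb{R}^{\mathcal{P}([n])\times\mathcal{P}([n])}$ by $\Lambda(\mathcal{G}) = \sum_{\sigma\in\Sigma}\sum_{X \in \mathcal{G}}\sum_{k\in[n]} ( e_{(P^{\sigma,X}_{k-1}, P^{\sigma,X}_k)} - e_{(P^{\sigma,X}_k, P^{\sigma,X}_{k-1})})$, where $e_{(Y,Z)}$ is the standard basis. $\mathcal{F}$ is called $\emptyset$-minimal if for every $a \in [n]$, $\Lambda(\mathcal{F}^*)_{(\emptyset, \{a\})} = \min\{\Lambda(\mathcal{F}^*)_{(A, A\cup\{a\})} : A \subseteq [n]\setminus\{a\}\}$. -}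

module Defs where

open import Data.Nat using (ℕ; zero; suc; _≤_; _*_)
import Data.Bool
import Data.Integer
open import Data.Bool using (Bool; true; false; not; _xor_; if_then_else_)
open import Data.Fin using (Fin)
open import Data.Fin.Subset using (Subset; ⁅_⁆; ∁; _∩_; _∪_; ∣_∣; Nonempty; _∉_; ⊥)
open import Data.Vec using (Vec; []; _∷_; zipWith)
import Data.Vec.Properties as VecP
import Data.List
open import Data.List using (List; []; _∷_; map; concatMap; filter; allFin)
open import Data.List.Relation.Unary.Unique.DecPropositional as UniqueDec using ()
import Data.Fin as F
open import Data.Product using (_×_; _,_)
open import Data.Integer using (ℤ; +_; _-_; _+_)
open import Relation.Nullary using (does)
open import Relation.Binary.PropositionalEquality using (_≡_)

Family : ℕ → Set
Family n = Subset n → Bool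

_∈F_ : ∀ {n} → Subset n → Family n → Set
A ∈F 𝓕 = 𝓕 A ≡ true

Intersecting : ∀ {n} → Family n → Set
Intersecting 𝓕 = ∀ A B → A ∈F 𝓕 → B ∈F 𝓕 → Nonempty (A ∩ B)

MaximalIntersecting : ∀ {n} → Family n → Set
MaximalIntersecting {n} 𝓕 =
  Intersecting 𝓕 ×
  (∀ (𝓖 : Family n) → Intersecting 𝓖 → (∀ A → A ∈F 𝓕 → A ∈F 𝓖) →
     ∀ A → A ∈F 𝓖 → A ∈F 𝓕)

Central : ∀ {n} → Family n → Set
Central {n} 𝓕 = ∀ A → A ∈F 𝓕 → n ≤ 2 * ∣ A ∣

_* : ∀ {n} → Family n → Family n
(𝓕 *) A = 𝓕 (∁ A)

_⊕_ : ∀ {n} → Subset n → Subset n → Subset n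
_⊕_ = zipWith _xor_

allSubsets : (n : ℕ) → List (Subset n)
allSubsets zero = [] ∷ []
allSubsets (suc n) = map (true ∷_) (allSubsets n) Data.List.++ map (false ∷_) (allSubsets n)

tuples : (m k : ℕ) → List (List (Fin m))
tuples m zero = [] ∷ []
tuples m (suc k) = concatMap (λ i → map (i ∷_) (tuples m k)) (allFin m)

-- Σ: the permutations of [n], each σ represented by the list
-- [σ(1), …, σ(n)] (lists of length n with no repeated entry)
perms : (n : ℕ) → List (List (Fin n))
perms n = filter (UniqueDec.unique? F._≟_) (tuples n n)

-- the consecutive pairs (P^{σ,X}_{k-1}, P^{σ,X}_k), k = 1..n
steps : ∀ {n} → Subset n → List (Fin n) → List (Subset n × Subset n)
steps X [] = []
steps X (a ∷ σ) = (X , X ⊕ ⁅ a ⁆) ∷ steps (X ⊕ ⁅ a ⁆) σ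

_≟S_ : ∀ {n} (A B : Subset n) → Bool
A ≟S B = does (VecP.≡-dec Data.Bool._≟_ A B)

δ : Bool → ℤ
δ b = if b then + 1 else + 0

-- contribution of one step (P,Q) to the entry (Y,Z) of
-- e_{(P,Q)} - e_{(Q,P)}
stepContribution : ∀ {n} → Subset n → Subset n → Subset n × Subset n → ℤ
stepContribution Y Z (P , Q) =
  δ ((P ≟S Y) Data.Bool.∧ (Q ≟S Z)) - δ ((Q ≟S Y) Data.Bool.∧ (P ≟S Z))

sumℤ : List ℤ → ℤ
sumℤ [] = + 0
sumℤ (x ∷ xs) = x + sumℤ xs

Λ : ∀ {n} → Family n → Subset n → Subset n → ℤ
Λ {n} 𝓖 Y Z =
  sumℤ (map (λ σ →
    sumℤ (map (λ X →
      if 𝓖 X then sumℤ (map (stepContribution Y Z) (steps X σ)) else + 0)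
      (allSubsets n)))
    (perms n))

-- ∅-minimal: for every a, Λ(𝓕*)_{(∅,{a})} equals the minimum of
-- Λ(𝓕*)_{(A, A ∪ {a})} over A ⊆ [n] ∖ {a}.  Since A = ∅ is among these,
-- this says Λ(𝓕*)_{(∅,{a})} ≤ Λ(𝓕*)_{(A, A∪{a})} for all such A.
EmptyMinimal : ∀ {n} → Family n → Set
EmptyMinimal {n} 𝓕 =
  ∀ (a : Fin n) (A : Subset n) → a ∉ A →
    Λ (𝓕 *) ⊥ ⁅ a ⁆ Data.Integer.≤ Λ (𝓕 *) A (A ∪ ⁅ a ⁆)

{-# OPTIONS --safe #-}
-- A walk P^{σ,X} moves in direction a exactly once, at the step where σ reaches a, and just
-- before that step it is at X ⊕ W, where W is the set of letters preceding a in σ.  Hence it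
-- contributes +1 to Λ(𝓖)_(Y, Y⊕{a}) when X ⊕ W = Y and −1 when X ⊕ W = Y ⊕ {a}, and
--   Λ(𝓖)_(Y, Y⊕{a}) = Σ_W (𝟙_𝓖(W) − 𝟙_𝓖(W ⊕ {a})) · c(W ⊕ Y),
-- where c(W) = |W|! (n − 1 − |W|)! is the number of permutations in which exactly the letters
-- of W precede a (and c(W) = 0 if a ∈ W).  For 𝓖 = 𝓕* the bracket is 0 or 1, because a
-- maximal intersecting family is an up-set.  When it is 1, ∁W ∈ 𝓕 but ∁W ∖ {a} ∉ 𝓕, so by
-- maximality W ∪ {a} ∈ 𝓕; centrality of ∁W and of W ∪ {a} forces |W| and n − 1 − |W| to
-- differ by at most one, which is exactly where |W|! (n − 1 − |W|)! is smallest.  So the sum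
-- for Y = ∅ is termwise at most the sum for Y = A.
module Submission where

-- The postfix _* of Defs would make every product on ℤ ambiguous.
open import Defs renaming (_* to _⋆)
open import Data.Bool using (Bool; true; false; not; _∧_; _∨_; _xor_; if_then_else_; T)
  renaming (_≟_ to _≟ᵇ_)
import Data.Bool.Properties as BoolP
open import Data.Empty using (⊥-elim)
open import Data.Fin using (Fin; zero; suc; _≟_)
open import Data.Fin.Subset
  using (Subset; ⁅_⁆; ∁; _∪_; _∩_; _─_; ∣_∣; _∈_; _∉_; _⊆_; Nonempty; ⊥)
import Data.Fin.Subset.Properties as SubsetP
open import Data.Integer as ℤ using (ℤ; +_; _+_; _-_; _*_)
import Data.Integer.Properties as ℤP
open import Data.Integer.Tactic.RingSolver using (solve-∀)
import Data.Nat.Tactic.RingSolver as ℕSolver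
open import Data.List using (List; []; _∷_; map; _++_; concatMap; filter; allFin)
import Data.List.Properties as ListP
open import Data.List.Relation.Unary.All as All using (All; []; _∷_)
open import Data.List.Relation.Unary.AllPairs.Core using ([]; _∷_)
import Data.List.Relation.Unary.Unique.DecPropositional as UniqueDec
open import Data.List.Relation.Unary.Unique.Propositional using (Unique)
open import Data.Nat as ℕ using (ℕ; zero; suc; pred; _!; _≤_)
import Data.Nat.Properties as ℕP
open import Data.Product using (_×_; _,_; proj₁; proj₂)
open import Data.Sum using (_⊎_; inj₁; inj₂)
open import Data.Vec using ([]; _∷_; lookup; here)
import Data.Vec.Properties as VecP
open import Function using (_∘_)
open import Relation.Nullary using (Dec; does; yes; no; ¬_)
open import Relation.Nullary.Decidable using (dec-true; dec-false; does-⇔; T?)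
open import Function.Bundles using (mk⇔)
open import Relation.Binary.PropositionalEquality
  using (_≡_; _≢_; refl; sym; trans; cong; cong₂; subst; subst₂; module ≡-Reasoning)

∑ : {A : Set} → List A → (A → ℤ) → ℤ
∑ xs f = sumℤ (map f xs)

infix 5 ∑
syntax ∑ xs (λ x → e) = ∑[ x ∈ xs ] e

∑-cong : {A : Set} (xs : List A) {f g : A → ℤ} → (∀ x → f x ≡ g x) → ∑ xs f ≡ ∑ xs g
∑-cong []       f≗g = refl
∑-cong (x ∷ xs) f≗g = cong₂ _+_ (f≗g x) (∑-cong xs f≗g)

∑-zero : {A : Set} (xs : List A) → ∑[ x ∈ xs ] + 0 ≡ + 0
∑-zero []       = refl
∑-zero (x ∷ xs) = trans (ℤP.+-identityˡ _) (∑-zero xs)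

∑-+ : {A : Set} (xs : List A) (f g : A → ℤ) → ∑[ x ∈ xs ] (f x + g x) ≡ ∑ xs f + ∑ xs g
∑-+ []       f g = refl
∑-+ (x ∷ xs) f g = trans (cong (_+_ (f x + g x)) (∑-+ xs f g)) (interchange (f x) (g x) _ _)
  where
  interchange : ∀ a b c d → (a + b) + (c + d) ≡ (a + c) + (b + d)
  interchange = solve-∀

∑-minus : {A : Set} (xs : List A) (f g : A → ℤ) → ∑[ x ∈ xs ] (f x - g x) ≡ ∑ xs f - ∑ xs g
∑-minus []       f g = refl
∑-minus (x ∷ xs) f g = trans (cong (_+_ (f x - g x)) (∑-minus xs f g)) (interchange (f x) (g x) _ _)
  where
  interchange : ∀ a b c d → (a - b) + (c - d) ≡ (a + c) - (b + d)
  interchange = solve-∀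

∑-*ˡ : {A : Set} (xs : List A) (c : ℤ) (f : A → ℤ) → ∑[ x ∈ xs ] (c * f x) ≡ c * ∑ xs f
∑-*ˡ []       c f = sym (ℤP.*-zeroʳ c)
∑-*ˡ (x ∷ xs) c f = trans (cong (_+_ (c * f x)) (∑-*ˡ xs c f)) (sym (ℤP.*-distribˡ-+ c (f x) (∑ xs f)))

∑-++ : {A : Set} (xs ys : List A) (f : A → ℤ) → ∑ (xs ++ ys) f ≡ ∑ xs f + ∑ ys f
∑-++ []       ys f = sym (ℤP.+-identityˡ _)
∑-++ (x ∷ xs) ys f = trans (cong (_+_ (f x)) (∑-++ xs ys f)) (sym (ℤP.+-assoc (f x) _ _))

∑-map : {A B : Set} (xs : List A) (g : A → B) (f : B → ℤ) → ∑ (map g xs) f ≡ ∑[ x ∈ xs ] f (g x)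
∑-map []       g f = refl
∑-map (x ∷ xs) g f = cong (_+_ (f (g x))) (∑-map xs g f)

∑-concatMap : {A B : Set} (xs : List A) (g : A → List B) (f : B → ℤ) →
  ∑ (concatMap g xs) f ≡ ∑[ x ∈ xs ] ∑ (g x) f
∑-concatMap []       g f = refl
∑-concatMap (x ∷ xs) g f = trans (∑-++ (g x) _ f) (cong (_+_ (∑ (g x) f)) (∑-concatMap xs g f))

∑-filter : {A : Set} {P : A → Set} (P? : ∀ x → Dec (P x)) (xs : List A) (f : A → ℤ) →
  ∑ (filter P? xs) f ≡ ∑[ x ∈ xs ] (if does (P? x) then f x else + 0)
∑-filter P? []       f = refl
∑-filter P? (x ∷ xs) f with does (P? x)
... | true  = cong (_+_ (f x)) (∑-filter P? xs f)
... | false = trans (∑-filter P? xs f) (sym (ℤP.+-identityˡ _))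

∑-mono-≤ : {A : Set} (xs : List A) {f g : A → ℤ} → (∀ x → f x ℤ.≤ g x) → ∑ xs f ℤ.≤ ∑ xs g
∑-mono-≤ []       f≤g = ℤP.≤-refl
∑-mono-≤ (x ∷ xs) f≤g = ℤP.+-mono-≤ (f≤g x) (∑-mono-≤ xs f≤g)

∑-comm : {A B : Set} (xs : List A) (ys : List B) (f : A → B → ℤ) →
  ∑[ x ∈ xs ] ∑[ y ∈ ys ] f x y ≡ ∑[ y ∈ ys ] ∑[ x ∈ xs ] f x y
∑-comm []       ys f = sym (∑-zero ys)
∑-comm (x ∷ xs) ys f =
  trans (cong (_+_ (∑ ys (f x))) (∑-comm xs ys f)) (sym (∑-+ ys (f x) (λ y → ∑[ x ∈ xs ] f x y)))

true≢false : true ≢ false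
true≢false ()

if-+ : ∀ b (x y : ℤ) → (if b then x + y else + 0) ≡ (if b then x else + 0) + (if b then y else + 0)
if-+ true  x y = refl
if-+ false x y = refl

if-minus : ∀ b (x y : ℤ) → (if b then x - y else + 0) ≡ (if b then x else + 0) - (if b then y else + 0)
if-minus true  x y = refl
if-minus false x y = refl

if-δ-∧ : ∀ g p q → (if g then δ (p ∧ q) else + 0) ≡ (if p then δ (g ∧ q) else + 0)
if-δ-∧ false false q = refl
if-δ-∧ false true  q = refl
if-δ-∧ true  false q = refl
if-δ-∧ true  true  q = refl

δ-∧-minus : ∀ g h b → δ (g ∧ b) - δ (h ∧ b) ≡ (if b then δ g - δ h else + 0)
δ-∧-minus g h false rewrite BoolP.∧-zeroʳ g | BoolP.∧-zeroʳ h = refl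
δ-∧-minus g h true  rewrite BoolP.∧-identityʳ g | BoolP.∧-identityʳ h = refl

⊕-identityˡ : ∀ {n} (X : Subset n) → ⊥ ⊕ X ≡ X
⊕-identityˡ = VecP.zipWith-identityˡ BoolP.xor-identityˡ

⊕-identityʳ : ∀ {n} (X : Subset n) → X ⊕ ⊥ ≡ X
⊕-identityʳ = VecP.zipWith-identityʳ BoolP.xor-identityʳ

⊕-comm : ∀ {n} (X Y : Subset n) → X ⊕ Y ≡ Y ⊕ X
⊕-comm = VecP.zipWith-comm BoolP.xor-comm

⊕-assoc : ∀ {n} (X Y Z : Subset n) → (X ⊕ Y) ⊕ Z ≡ X ⊕ (Y ⊕ Z)
⊕-assoc = VecP.zipWith-assoc BoolP.xor-assoc

⊕-self : ∀ {n} (X : Subset n) → X ⊕ X ≡ ⊥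
⊕-self []      = refl
⊕-self (x ∷ X) = cong₂ _∷_ (BoolP.xor-same x) (⊕-self X)

⊕-cancelʳ : ∀ {n} (X Y : Subset n) → (X ⊕ Y) ⊕ Y ≡ X
⊕-cancelʳ X Y = trans (⊕-assoc X Y Y) (trans (cong (X ⊕_) (⊕-self Y)) (⊕-identityʳ X))

⊕-cancelˡ : ∀ {n} (Y X : Subset n) → Y ⊕ (Y ⊕ X) ≡ X
⊕-cancelˡ Y X = trans (sym (⊕-assoc Y Y X)) (trans (cong (_⊕ X) (⊕-self Y)) (⊕-identityˡ X))

⊕-injectiveʳ : ∀ {n} (X : Subset n) {Y Z : Subset n} → Y ⊕ X ≡ Z ⊕ X → Y ≡ Z
⊕-injectiveʳ X {Y} {Z} eq = trans (sym (⊕-cancelʳ Y X)) (trans (cong (_⊕ X) eq) (⊕-cancelʳ Z X))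

⊕-injectiveˡ : ∀ {n} (X : Subset n) {Y Z : Subset n} → X ⊕ Y ≡ X ⊕ Z → Y ≡ Z
⊕-injectiveˡ X {Y} {Z} eq = ⊕-injectiveʳ X (trans (⊕-comm Y X) (trans eq (⊕-comm X Z)))

lookup-⊕ : ∀ {n} (X Y : Subset n) i → lookup (X ⊕ Y) i ≡ (lookup X i xor lookup Y i)
lookup-⊕ X Y i = VecP.lookup-zipWith _xor_ i X Y

lookup-⊥ : ∀ {n} (i : Fin n) → lookup (⊥ {n}) i ≡ false
lookup-⊥ i = VecP.lookup-replicate i false

lookup-⁅⁆ : ∀ {n} (a i : Fin n) → lookup ⁅ a ⁆ i ≡ does (i ≟ a)
lookup-⁅⁆ zero    zero    = refl
lookup-⁅⁆ zero    (suc i) = lookup-⊥ i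
lookup-⁅⁆ (suc a) zero    = refl
lookup-⁅⁆ (suc a) (suc i) with i ≟ a | lookup-⁅⁆ a i
... | yes _ | eq = eq
... | no  _ | eq = eq

∁-involutive : ∀ {n} (p : Subset n) → ∁ (∁ p) ≡ p
∁-involutive []      = refl
∁-involutive (x ∷ p) = cong₂ _∷_ (BoolP.not-involutive x) (∁-involutive p)

∉⇒lookup≡false : ∀ {n} {x : Fin n} {p : Subset n} → x ∉ p → lookup p x ≡ false
∉⇒lookup≡false {x = x} {p} x∉p with lookup p x in eq
... | true  = ⊥-elim (x∉p (VecP.lookup⇒[]= x p eq))
... | false = refl

lookup≡false⇒∉ : ∀ {n} {x : Fin n} {p : Subset n} → lookup p x ≡ false → x ∉ p
lookup≡false⇒∉ x∉p x∈p with trans (sym (VecP.[]=⇒lookup x∈p)) x∉p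
... | ()

lookup-toggle : ∀ {n} (B : Subset n) (i y : Fin n) → lookup (B ⊕ ⁅ i ⁆) y ≡ (lookup B y xor does (y ≟ i))
lookup-toggle B i y = trans (lookup-⊕ B ⁅ i ⁆ y) (cong (lookup B y xor_) (lookup-⁅⁆ i y))

lookup-toggle-≢ : ∀ {n} (B : Subset n) {i y : Fin n} → y ≢ i → lookup (B ⊕ ⁅ i ⁆) y ≡ lookup B y
lookup-toggle-≢ B {i} {y} y≢i =
  trans (lookup-toggle B i y) (trans (cong (lookup B y xor_) (dec-false (y ≟ i) y≢i)) (BoolP.xor-identityʳ _))

lookup-toggle-self : ∀ {n} (B : Subset n) (i : Fin n) → lookup B i ≡ false → lookup (B ⊕ ⁅ i ⁆) i ≡ true
lookup-toggle-self B i i∉B = trans (lookup-toggle B i i) (cong₂ _xor_ i∉B (dec-true (i ≟ i) refl))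

⁅⁆-injective : ∀ {n} {i a : Fin n} → ⁅ i ⁆ ≡ ⁅ a ⁆ → i ≡ a
⁅⁆-injective {i = i} {a} eq = SubsetP.x∈⁅y⁆⇒x≡y a (subst (i ∈_) eq (SubsetP.x∈⁅x⁆ i))

toggle≡∪ : ∀ {n} (B : Subset n) (i : Fin n) → lookup B i ≡ false → B ⊕ ⁅ i ⁆ ≡ B ∪ ⁅ i ⁆
toggle≡∪ (false ∷ B) zero    refl = cong (true ∷_) (trans (⊕-identityʳ B) (sym (SubsetP.∪-identityʳ B)))
toggle≡∪ (b     ∷ B) (suc i) i∉B  =
  cong₂ _∷_ (trans (BoolP.xor-identityʳ b) (sym (BoolP.∨-identityʳ b))) (toggle≡∪ B i i∉B)

⊆-toggle : ∀ {n} (B : Subset n) {i : Fin n} → lookup B i ≡ false → B ⊆ B ⊕ ⁅ i ⁆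
⊆-toggle B {i} i∉B = subst (B ⊆_) (sym (toggle≡∪ B i i∉B)) (SubsetP.p⊆p∪q ⁅ i ⁆)

toggle-⊆ : ∀ {n} {B W : Subset n} {i : Fin n} → lookup B i ≡ false → B ⊆ W → i ∈ W → B ⊕ ⁅ i ⁆ ⊆ W
toggle-⊆ {B = B} {W} {i} i∉B B⊆W i∈W x∈ with SubsetP.x∈p∪q⁻ B ⁅ i ⁆ (subst (_ ∈_) (toggle≡∪ B i i∉B) x∈)
... | inj₁ x∈B  = B⊆W x∈B
... | inj₂ x∈⁅i⁆ rewrite SubsetP.x∈⁅y⁆⇒x≡y i x∈⁅i⁆ = i∈W

≟S-sound : ∀ {n} (X Y : Subset n) → (X ≟S Y) ≡ true → X ≡ Y
≟S-sound X Y eq with VecP.≡-dec _≟ᵇ_ X Y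
... | yes X≡Y = X≡Y

≟S-complete : ∀ {n} {X Y : Subset n} → X ≡ Y → (X ≟S Y) ≡ true
≟S-complete {X = X} {Y} = dec-true (VecP.≡-dec _≟ᵇ_ X Y)

toggle-≟S-toggle : ∀ {n} (Y : Subset n) (i a : Fin n) → ((Y ⊕ ⁅ i ⁆) ≟S (Y ⊕ ⁅ a ⁆)) ≡ does (i ≟ a)
toggle-≟S-toggle Y i a =
  does-⇔ (mk⇔ (⁅⁆-injective ∘ ⊕-injectiveˡ Y) (cong (λ j → Y ⊕ ⁅ j ⁆))) (VecP.≡-dec _≟ᵇ_ _ _) (i ≟ a)

toggle²-≟S : ∀ {n} (Y : Subset n) (i a : Fin n) → (((Y ⊕ ⁅ a ⁆) ⊕ ⁅ i ⁆) ≟S Y) ≡ does (i ≟ a)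
toggle²-≟S Y i a = does-⇔ (mk⇔ to from) (VecP.≡-dec _≟ᵇ_ _ _) (i ≟ a)
  where
  to : (Y ⊕ ⁅ a ⁆) ⊕ ⁅ i ⁆ ≡ Y → i ≡ a
  to eq = sym (⁅⁆-injective (⊕-injectiveˡ Y (trans (sym (⊕-cancelʳ (Y ⊕ ⁅ a ⁆) ⁅ i ⁆)) (cong (_⊕ ⁅ i ⁆) eq))))
  from : i ≡ a → (Y ⊕ ⁅ a ⁆) ⊕ ⁅ i ⁆ ≡ Y
  from refl = ⊕-cancelʳ Y ⁅ i ⁆

∑-allSubsets-suc : ∀ n (f : Subset (suc n) → ℤ) →
  ∑ (allSubsets (suc n)) f ≡ (∑[ X ∈ allSubsets n ] f (true ∷ X)) + (∑[ X ∈ allSubsets n ] f (false ∷ X))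
∑-allSubsets-suc n f = trans (∑-++ (map (true ∷_) (allSubsets n)) _ f)
  (cong₂ _+_ (∑-map (allSubsets n) (true ∷_) f) (∑-map (allSubsets n) (false ∷_) f))

∑-allSubsets-pick : ∀ n (f : Subset n → ℤ) (Y : Subset n) →
  ∑[ X ∈ allSubsets n ] (if X ≟S Y then f X else + 0) ≡ f Y
∑-allSubsets-pick zero    f []          = ℤP.+-identityʳ (f [])
∑-allSubsets-pick (suc n) f (true ∷ Y)  = trans (∑-allSubsets-suc n _)
  (trans (cong₂ _+_ (∑-allSubsets-pick n (f ∘ (true ∷_)) Y) (∑-zero (allSubsets n))) (ℤP.+-identityʳ _))
∑-allSubsets-pick (suc n) f (false ∷ Y) = trans (∑-allSubsets-suc n _)
  (trans (cong₂ _+_ (∑-zero (allSubsets n)) (∑-allSubsets-pick n (f ∘ (false ∷_)) Y)) (ℤP.+-identityˡ _))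

∑-allSubsets-⊕ : ∀ n (V : Subset n) (f : Subset n → ℤ) → ∑[ X ∈ allSubsets n ] f (X ⊕ V) ≡ ∑ (allSubsets n) f
∑-allSubsets-⊕ zero    []          f = refl
∑-allSubsets-⊕ (suc n) (false ∷ V) f = begin
  ∑[ X ∈ allSubsets (suc n) ] f (X ⊕ (false ∷ V))
    ≡⟨ ∑-allSubsets-suc n _ ⟩
  (∑[ X ∈ allSubsets n ] f (true ∷ (X ⊕ V))) + (∑[ X ∈ allSubsets n ] f (false ∷ (X ⊕ V)))
    ≡⟨ cong₂ _+_ (∑-allSubsets-⊕ n V (f ∘ (true ∷_))) (∑-allSubsets-⊕ n V (f ∘ (false ∷_))) ⟩
  (∑[ X ∈ allSubsets n ] f (true ∷ X)) + (∑[ X ∈ allSubsets n ] f (false ∷ X))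
    ≡⟨ ∑-allSubsets-suc n f ⟨
  ∑ (allSubsets (suc n)) f ∎
  where open ≡-Reasoning
∑-allSubsets-⊕ (suc n) (true ∷ V)  f = begin
  ∑[ X ∈ allSubsets (suc n) ] f (X ⊕ (true ∷ V))
    ≡⟨ ∑-allSubsets-suc n _ ⟩
  (∑[ X ∈ allSubsets n ] f (false ∷ (X ⊕ V))) + (∑[ X ∈ allSubsets n ] f (true ∷ (X ⊕ V)))
    ≡⟨ cong₂ _+_ (∑-allSubsets-⊕ n V (f ∘ (false ∷_))) (∑-allSubsets-⊕ n V (f ∘ (true ∷_))) ⟩
  (∑[ X ∈ allSubsets n ] f (false ∷ X)) + (∑[ X ∈ allSubsets n ] f (true ∷ X))
    ≡⟨ ℤP.+-comm (∑[ X ∈ allSubsets n ] f (false ∷ X)) _ ⟩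
  (∑[ X ∈ allSubsets n ] f (true ∷ X)) + (∑[ X ∈ allSubsets n ] f (false ∷ X))
    ≡⟨ ∑-allSubsets-suc n f ⟨
  ∑ (allSubsets (suc n)) f ∎
  where open ≡-Reasoning

∑-allFin-suc : ∀ n (f : Fin (suc n) → ℤ) → ∑ (allFin (suc n)) f ≡ f zero + ∑ (allFin n) (f ∘ suc)
∑-allFin-suc n f = cong (λ xs → f zero + sumℤ xs)
  (trans (ListP.map-tabulate suc f) (sym (ListP.map-tabulate (λ i → i) (f ∘ suc))))

∑-allFin-pick : ∀ n (a : Fin n) (f : Fin n → ℤ) → ∑[ i ∈ allFin n ] (if does (i ≟ a) then f i else + 0) ≡ f a
∑-allFin-pick (suc n) zero    f = trans (∑-allFin-suc n (λ i → if does (i ≟ zero) then f i else + 0))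
  (trans (cong (_+_ (f zero)) (∑-zero (allFin n))) (ℤP.+-identityʳ _))
∑-allFin-pick (suc n) (suc a) f = trans (∑-allFin-suc n (λ i → if does (i ≟ suc a) then f i else + 0))
  (trans (ℤP.+-identityˡ _) (trans (∑-cong (allFin n) suc≟suc) (∑-allFin-pick n a (f ∘ suc))))
  where
  suc≟suc : ∀ i → (if does (suc i ≟ suc a) then f (suc i) else + 0) ≡ (if does (i ≟ a) then f (suc i) else + 0)
  suc≟suc i with i ≟ a
  ... | yes _ = refl
  ... | no  _ = refl

+suc-* : ∀ m (c : ℤ) → + suc m * c ≡ c + + m * c
+suc-* m c = lemma (+ m) c
  where
  lemma : ∀ x c → (+ 1 + x) * c ≡ c + x * c
  lemma = solve-∀

∑-allFin-outside : ∀ {n} (B : Subset n) (c : ℤ) → ∑[ i ∈ allFin n ] (if lookup B i then + 0 else c) ≡ + ∣ ∁ B ∣ * c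
∑-allFin-outside []          c = refl
∑-allFin-outside (true ∷ B)  c = trans (∑-allFin-suc _ (λ i → if lookup (true ∷ B) i then + 0 else c))
  (trans (ℤP.+-identityˡ _) (∑-allFin-outside B c))
∑-allFin-outside (false ∷ B) c = trans (∑-allFin-suc _ (λ i → if lookup (false ∷ B) i then + 0 else c))
  (trans (cong (_+_ c) (∑-allFin-outside B c)) (sym (+suc-* ∣ ∁ B ∣ c)))

private
  summand : ∀ {n} (W B : Subset n) (c : ℤ) → Fin n → ℤ
  summand W B c i = if lookup B i then + 0 else (if lookup W i then c else + 0)

∑-allFin-─ : ∀ {n} (W B : Subset n) (c : ℤ) →
  ∑[ i ∈ allFin n ] (if lookup B i then + 0 else (if lookup W i then c else + 0)) ≡ + ∣ W ─ B ∣ * c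
∑-allFin-─ []          []          c = refl
∑-allFin-─ (w ∷ W)     (true ∷ B)  c = trans (∑-allFin-suc _ (summand (w ∷ W) (true ∷ B) c))
  (trans (ℤP.+-identityˡ _) (∑-allFin-─ W B c))
∑-allFin-─ (true ∷ W)  (false ∷ B) c = trans (∑-allFin-suc _ (summand (true ∷ W) (false ∷ B) c))
  (trans (cong (_+_ c) (∑-allFin-─ W B c)) (sym (+suc-* ∣ W ─ B ∣ c)))
∑-allFin-─ (false ∷ W) (false ∷ B) c = trans (∑-allFin-suc _ (summand (false ∷ W) (false ∷ B) c))
  (trans (ℤP.+-identityˡ _) (∑-allFin-─ W B c))

-- Λ along an edge of the cube

flipSum : ∀ {n} → Fin n → (Subset n → ℤ) → Subset n → List (Fin n) → ℤ
flipSum a E P []      = + 0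
flipSum a E P (i ∷ σ) = (if does (i ≟ a) then E P else + 0) + flipSum a E (P ⊕ ⁅ i ⁆) σ

walkSum : ∀ {n} → Subset n → Subset n → Subset n → List (Fin n) → ℤ
walkSum Y Z X σ = sumℤ (map (stepContribution Y Z) (steps X σ))

module _ {n : ℕ} (Y Z : Subset n) where

  ∑-stepContribution : ∀ (G : Family n) i →
    ∑[ X ∈ allSubsets n ] (if G X then stepContribution Y Z (X , X ⊕ ⁅ i ⁆) else + 0)
      ≡ δ (G Y ∧ ((Y ⊕ ⁅ i ⁆) ≟S Z)) - δ (G Z ∧ ((Z ⊕ ⁅ i ⁆) ≟S Y))
  ∑-stepContribution G i = begin
    ∑[ X ∈ allSubsets n ] (if G X then stepContribution Y Z (X , X ⊕ ⁅ i ⁆) else + 0)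
      ≡⟨ ∑-cong (allSubsets n) swapGuards ⟩
    ∑[ X ∈ allSubsets n ] ((if X ≟S Y then δ (G X ∧ ((X ⊕ ⁅ i ⁆) ≟S Z)) else + 0)
                           - (if X ≟S Z then δ (G X ∧ ((X ⊕ ⁅ i ⁆) ≟S Y)) else + 0))
      ≡⟨ ∑-minus (allSubsets n) _ _ ⟩
    (∑[ X ∈ allSubsets n ] (if X ≟S Y then δ (G X ∧ ((X ⊕ ⁅ i ⁆) ≟S Z)) else + 0))
      - (∑[ X ∈ allSubsets n ] (if X ≟S Z then δ (G X ∧ ((X ⊕ ⁅ i ⁆) ≟S Y)) else + 0))
      ≡⟨ cong₂ _-_ (∑-allSubsets-pick n _ Y) (∑-allSubsets-pick n _ Z) ⟩
    δ (G Y ∧ ((Y ⊕ ⁅ i ⁆) ≟S Z)) - δ (G Z ∧ ((Z ⊕ ⁅ i ⁆) ≟S Y)) ∎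
    where
    open ≡-Reasoning
    swapGuards : ∀ X → (if G X then stepContribution Y Z (X , X ⊕ ⁅ i ⁆) else + 0)
      ≡ (if X ≟S Y then δ (G X ∧ ((X ⊕ ⁅ i ⁆) ≟S Z)) else + 0)
        - (if X ≟S Z then δ (G X ∧ ((X ⊕ ⁅ i ⁆) ≟S Y)) else + 0)
    swapGuards X = trans (if-minus (G X) _ _) (cong₂ _-_ (if-δ-∧ (G X) (X ≟S Y) ((X ⊕ ⁅ i ⁆) ≟S Z))
      (trans (cong (λ b → if G X then δ b else + 0) (BoolP.∧-comm ((X ⊕ ⁅ i ⁆) ≟S Y) (X ≟S Z)))
             (if-δ-∧ (G X) (X ≟S Z) ((X ⊕ ⁅ i ⁆) ≟S Y))))

module _ {n : ℕ} (G : Family n) (Y : Subset n) (a : Fin n) where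

  edgeFlow : Subset n → ℤ
  edgeFlow P = δ (G (Y ⊕ P)) - δ (G ((Y ⊕ ⁅ a ⁆) ⊕ P))

  ∑-walkSum : ∀ σ P (H : Family n) → (∀ X → H X ≡ G (X ⊕ P)) →
    ∑[ X ∈ allSubsets n ] (if H X then walkSum Y (Y ⊕ ⁅ a ⁆) X σ else + 0) ≡ flipSum a edgeFlow P σ
  ∑-walkSum []      P H H≗G = trans (∑-cong (allSubsets n) (λ X → if-zero (H X))) (∑-zero (allSubsets n))
    where
    if-zero : ∀ b → (if b then + 0 else + 0) ≡ + 0
    if-zero true  = refl
    if-zero false = refl
  ∑-walkSum (i ∷ σ) P H H≗G = begin
    ∑[ X ∈ allSubsets n ] (if H X then walkSum Y Z X (i ∷ σ) else + 0)
      ≡⟨ ∑-cong (allSubsets n) (λ X → if-+ (H X) _ _) ⟩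
    ∑[ X ∈ allSubsets n ] ((if H X then stepContribution Y Z (X , X ⊕ ⁅ i ⁆) else + 0)
                           + (if H X then walkSum Y Z (X ⊕ ⁅ i ⁆) σ else + 0))
      ≡⟨ ∑-+ (allSubsets n) _ _ ⟩
    (∑[ X ∈ allSubsets n ] (if H X then stepContribution Y Z (X , X ⊕ ⁅ i ⁆) else + 0))
      + (∑[ X ∈ allSubsets n ] (if H X then walkSum Y Z (X ⊕ ⁅ i ⁆) σ else + 0))
      ≡⟨ cong₂ _+_ firstStep (trans (∑-cong (allSubsets n) (sym ∘ cancel)) (∑-allSubsets-⊕ n ⁅ i ⁆ _)) ⟩
    (if does (i ≟ a) then edgeFlow P else + 0)
      + (∑[ X ∈ allSubsets n ] (if H (X ⊕ ⁅ i ⁆) then walkSum Y Z X σ else + 0))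
      ≡⟨ cong (_+_ (if does (i ≟ a) then edgeFlow P else + 0))
              (∑-walkSum σ (P ⊕ ⁅ i ⁆) (λ X → H (X ⊕ ⁅ i ⁆)) shifted) ⟩
    flipSum a edgeFlow P (i ∷ σ) ∎
    where
    open ≡-Reasoning
    Z : Subset n
    Z = Y ⊕ ⁅ a ⁆
    firstStep : ∑[ X ∈ allSubsets n ] (if H X then stepContribution Y Z (X , X ⊕ ⁅ i ⁆) else + 0)
      ≡ (if does (i ≟ a) then edgeFlow P else + 0)
    firstStep = begin
      _ ≡⟨ ∑-stepContribution Y Z H i ⟩
      δ (H Y ∧ ((Y ⊕ ⁅ i ⁆) ≟S Z)) - δ (H Z ∧ ((Z ⊕ ⁅ i ⁆) ≟S Y))
        ≡⟨ cong₂ (λ b c → δ (H Y ∧ b) - δ (H Z ∧ c)) (toggle-≟S-toggle Y i a) (toggle²-≟S Y i a) ⟩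
      δ (H Y ∧ does (i ≟ a)) - δ (H Z ∧ does (i ≟ a))
        ≡⟨ δ-∧-minus (H Y) (H Z) (does (i ≟ a)) ⟩
      (if does (i ≟ a) then δ (H Y) - δ (H Z) else + 0)
        ≡⟨ cong₂ (λ u v → if does (i ≟ a) then δ u - δ v else + 0) (H≗G Y) (H≗G Z) ⟩
      (if does (i ≟ a) then edgeFlow P else + 0) ∎
    cancel : ∀ X → (if H ((X ⊕ ⁅ i ⁆) ⊕ ⁅ i ⁆) then walkSum Y Z (X ⊕ ⁅ i ⁆) σ else + 0)
      ≡ (if H X then walkSum Y Z (X ⊕ ⁅ i ⁆) σ else + 0)
    cancel X = cong (λ W → if H W then walkSum Y Z (X ⊕ ⁅ i ⁆) σ else + 0) (⊕-cancelʳ X ⁅ i ⁆)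
    shifted : ∀ X → H (X ⊕ ⁅ i ⁆) ≡ G (X ⊕ (P ⊕ ⁅ i ⁆))
    shifted X = trans (H≗G (X ⊕ ⁅ i ⁆))
      (cong G (trans (⊕-assoc X ⁅ i ⁆ P) (cong (X ⊕_) (⊕-comm ⁅ i ⁆ P))))

  Λ-edge-flipSum : Λ G Y (Y ⊕ ⁅ a ⁆) ≡ ∑[ σ ∈ perms n ] flipSum a edgeFlow ⊥ σ
  Λ-edge-flipSum = ∑-cong (perms n) (λ σ → ∑-walkSum σ ⊥ G (λ X → cong G (sym (⊕-identityʳ X))))

𝟙[_] : ∀ {n} → Subset n → Subset n → ℤ
𝟙[ W ] Q = δ (W ≟S Q)

flipSum-linear : ∀ {n} (a : Fin n) (E : Subset n → ℤ) P σ →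
  flipSum a E P σ ≡ ∑[ W ∈ allSubsets n ] (E W * flipSum a 𝟙[ W ] P σ)
flipSum-linear {n} a E P []      = sym (trans (∑-cong (allSubsets n) (ℤP.*-zeroʳ ∘ E)) (∑-zero (allSubsets n)))
flipSum-linear {n} a E P (i ∷ σ) = sym (begin
  ∑[ W ∈ allSubsets n ] (E W * ((if does (i ≟ a) then 𝟙[ W ] P else + 0) + flipSum a 𝟙[ W ] (P ⊕ ⁅ i ⁆) σ))
    ≡⟨ ∑-cong (allSubsets n) (λ W → ℤP.*-distribˡ-+ (E W) _ _) ⟩
  ∑[ W ∈ allSubsets n ] (E W * (if does (i ≟ a) then 𝟙[ W ] P else + 0) + E W * flipSum a 𝟙[ W ] (P ⊕ ⁅ i ⁆) σ)
    ≡⟨ ∑-+ (allSubsets n) _ _ ⟩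
  (∑[ W ∈ allSubsets n ] (E W * (if does (i ≟ a) then 𝟙[ W ] P else + 0)))
    + (∑[ W ∈ allSubsets n ] (E W * flipSum a 𝟙[ W ] (P ⊕ ⁅ i ⁆) σ))
    ≡⟨ cong₂ _+_ (pickP (does (i ≟ a))) (sym (flipSum-linear a E (P ⊕ ⁅ i ⁆) σ)) ⟩
  flipSum a E P (i ∷ σ) ∎)
  where
  open ≡-Reasoning
  *δ : ∀ W → E W * δ (W ≟S P) ≡ (if W ≟S P then E W else + 0)
  *δ W with W ≟S P
  ... | true  = ℤP.*-identityʳ (E W)
  ... | false = ℤP.*-zeroʳ (E W)
  pickP : ∀ d → ∑[ W ∈ allSubsets n ] (E W * (if d then 𝟙[ W ] P else + 0)) ≡ (if d then E P else + 0)
  pickP true  = trans (∑-cong (allSubsets n) *δ) (∑-allSubsets-pick n E P)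
  pickP false = trans (∑-cong (allSubsets n) (ℤP.*-zeroʳ ∘ E)) (∑-zero (allSubsets n))

-- The number of permutations in which the letters preceding a are exactly those of W.
prefixCount : ∀ {n} → Fin n → Subset n → ℤ
prefixCount {n} a W = ∑[ σ ∈ perms n ] flipSum a 𝟙[ W ] ⊥ σ

∑-flipSum : ∀ {n} (a : Fin n) (E : Subset n → ℤ) →
  ∑[ σ ∈ perms n ] flipSum a E ⊥ σ ≡ ∑[ W ∈ allSubsets n ] (E W * prefixCount a W)
∑-flipSum {n} a E = begin
  ∑[ σ ∈ perms n ] flipSum a E ⊥ σ
    ≡⟨ ∑-cong (perms n) (flipSum-linear a E ⊥) ⟩
  ∑[ σ ∈ perms n ] ∑[ W ∈ allSubsets n ] (E W * flipSum a 𝟙[ W ] ⊥ σ)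
    ≡⟨ ∑-comm (perms n) (allSubsets n) _ ⟩
  ∑[ W ∈ allSubsets n ] ∑[ σ ∈ perms n ] (E W * flipSum a 𝟙[ W ] ⊥ σ)
    ≡⟨ ∑-cong (allSubsets n) (λ W → ∑-*ˡ (perms n) (E W) _) ⟩
  ∑[ W ∈ allSubsets n ] (E W * prefixCount a W) ∎
  where open ≡-Reasoning

∂ : ∀ {n} → Family n → Fin n → Subset n → ℤ
∂ G a W = δ (G W) - δ (G (W ⊕ ⁅ a ⁆))

Λ-edge : ∀ {n} (G : Family n) (Y : Subset n) (a : Fin n) →
  Λ G Y (Y ⊕ ⁅ a ⁆) ≡ ∑[ W ∈ allSubsets n ] (∂ G a W * prefixCount a (W ⊕ Y))
Λ-edge {n} G Y a = begin
  Λ G Y (Y ⊕ ⁅ a ⁆)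
    ≡⟨ Λ-edge-flipSum G Y a ⟩
  ∑[ σ ∈ perms n ] flipSum a (edgeFlow G Y a) ⊥ σ
    ≡⟨ ∑-flipSum a (edgeFlow G Y a) ⟩
  ∑[ P ∈ allSubsets n ] (edgeFlow G Y a P * prefixCount a P)
    ≡⟨ ∑-allSubsets-⊕ n Y _ ⟨
  ∑[ W ∈ allSubsets n ] (edgeFlow G Y a (W ⊕ Y) * prefixCount a (W ⊕ Y))
    ≡⟨ ∑-cong (allSubsets n) (λ W → cong (λ e → e * prefixCount a (W ⊕ Y)) (translate W)) ⟩
  ∑[ W ∈ allSubsets n ] (∂ G a W * prefixCount a (W ⊕ Y)) ∎
  where
  open ≡-Reasoning
  translate : ∀ W → edgeFlow G Y a (W ⊕ Y) ≡ ∂ G a W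
  translate W = cong₂ (λ U V → δ (G U) - δ (G V))
    (trans (⊕-comm Y (W ⊕ Y)) (⊕-cancelʳ W Y))
    (trans (⊕-comm (Y ⊕ ⁅ a ⁆) (W ⊕ Y)) (trans (⊕-assoc W Y (Y ⊕ ⁅ a ⁆)) (cong (W ⊕_) (⊕-cancelˡ Y ⁅ a ⁆))))

-- Counting permutations by the letters preceding a

fresh : ∀ {n} → Subset n → List (Fin n) → Bool
fresh B []      = true
fresh B (i ∷ t) = not (lookup B i) ∧ fresh (B ⊕ ⁅ i ⁆) t

Avoids : ∀ {n} → Subset n → List (Fin n) → Set
Avoids B = All (λ y → lookup B y ≡ false)

fresh-sound : ∀ {n} (B : Subset n) t → T (fresh B t) → Unique t × Avoids B t
fresh-sound B []      _ = [] , []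
fresh-sound B (i ∷ t) h with lookup B i in i∉B
... | false with fresh-sound (B ⊕ ⁅ i ⁆) t h
...   | unique , avoids = All.map i≢ avoids ∷ unique , i∉B ∷ All.map avoidsB avoids
  where
  i≢ : ∀ {y} → lookup (B ⊕ ⁅ i ⁆) y ≡ false → i ≢ y
  i≢ y∉ refl with trans (sym (lookup-toggle-self B i i∉B)) y∉
  ... | ()
  avoidsB : ∀ {y} → lookup (B ⊕ ⁅ i ⁆) y ≡ false → lookup B y ≡ false
  avoidsB {y} y∉ with y ≟ i
  ... | yes refl = i∉B
  ... | no  y≢i  = trans (sym (lookup-toggle-≢ B y≢i)) y∉

fresh-complete : ∀ {n} (B : Subset n) t → Unique t → Avoids B t → T (fresh B t)
fresh-complete B []      _                  _              = _
fresh-complete B (i ∷ t) (i∉t ∷ unique) (i∉B ∷ avoids) rewrite i∉B =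
  fresh-complete (B ⊕ ⁅ i ⁆) t unique
    (All.zipWith (λ (i≢y , y∉B) → trans (lookup-toggle-≢ B (i≢y ∘ sym)) y∉B) (i∉t , avoids))

unique?≡fresh : ∀ {n} (t : List (Fin n)) → does (UniqueDec.unique? _≟_ t) ≡ fresh ⊥ t
unique?≡fresh t =
  does-⇔ (mk⇔ (λ u → fresh-complete ⊥ t u (All.universal lookup-⊥ t)) (proj₁ ∘ fresh-sound ⊥ t))
    (UniqueDec.unique? _≟_ t) (T? (fresh ⊥ t))

∑fresh : ∀ {n} → ℕ → Subset n → (List (Fin n) → ℤ) → ℤ
∑fresh {n} k B g = ∑[ t ∈ tuples n k ] (if fresh B t then g t else + 0)

prefixCount≡∑fresh : ∀ {n} (a : Fin n) (W : Subset n) →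
  prefixCount a W ≡ ∑fresh n ⊥ (flipSum a 𝟙[ W ] ⊥)
prefixCount≡∑fresh {n} a W = trans (∑-filter (UniqueDec.unique? _≟_) (tuples n n) _)
  (∑-cong (tuples n n) (λ t → cong (λ b → if b then flipSum a 𝟙[ W ] ⊥ t else + 0) (unique?≡fresh t)))

∑fresh-suc : ∀ {n} k (B : Subset n) g → ∑fresh (suc k) B g
  ≡ ∑[ i ∈ allFin n ] (if lookup B i then + 0 else ∑fresh k (B ⊕ ⁅ i ⁆) (g ∘ (i ∷_)))
∑fresh-suc {n} k B g = trans (∑-concatMap (allFin n) (λ i → map (i ∷_) (tuples n k)) _)
  (∑-cong (allFin n) (λ i → trans (∑-map (tuples n k) (i ∷_) _) (firstFresh i)))
  where
  firstFresh : ∀ i → ∑[ t ∈ tuples n k ] (if fresh B (i ∷ t) then g (i ∷ t) else + 0)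
    ≡ (if lookup B i then + 0 else ∑fresh k (B ⊕ ⁅ i ⁆) (g ∘ (i ∷_)))
  firstFresh i with lookup B i
  ... | true  = ∑-zero (tuples n k)
  ... | false = refl

∑fresh-+ : ∀ {n} k (B : Subset n) g h → ∑fresh k B (λ t → g t + h t) ≡ ∑fresh k B g + ∑fresh k B h
∑fresh-+ {n} k B g h = trans (∑-cong (tuples n k) (λ t → if-+ (fresh B t) (g t) (h t))) (∑-+ (tuples n k) _ _)

freshCount : ∀ {n} → ℕ → Subset n → ℤ
freshCount k B = ∑fresh k B (λ _ → + 1)

∑fresh-const : ∀ {n} k (B : Subset n) c → ∑fresh k B (λ _ → c) ≡ c * freshCount k B
∑fresh-const {n} k B c = trans (∑-cong (tuples n k) (λ t → if-* (fresh B t))) (∑-*ˡ (tuples n k) c _)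
  where
  if-* : ∀ b → (if b then c else + 0) ≡ c * (if b then + 1 else + 0)
  if-* true  = sym (ℤP.*-identityʳ c)
  if-* false = sym (ℤP.*-zeroʳ c)

∣∁toggle∣ : ∀ {n} (B : Subset n) (i : Fin n) → lookup B i ≡ false → ∣ ∁ B ∣ ≡ suc ∣ ∁ (B ⊕ ⁅ i ⁆) ∣
∣∁toggle∣ (false ∷ B) zero    _   rewrite ⊕-identityʳ B = refl
∣∁toggle∣ (true ∷ B)  (suc i) i∉B = ∣∁toggle∣ B i i∉B
∣∁toggle∣ (false ∷ B) (suc i) i∉B = cong suc (∣∁toggle∣ B i i∉B)

∣─toggle∣ : ∀ {n} (W B : Subset n) (i : Fin n) → lookup B i ≡ false → lookup W i ≡ true →
  ∣ W ─ B ∣ ≡ suc ∣ W ─ (B ⊕ ⁅ i ⁆) ∣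
∣─toggle∣ (true ∷ W)  (false ∷ B) zero    _   _   rewrite ⊕-identityʳ B = refl
∣─toggle∣ (w ∷ W)     (true ∷ B)  (suc i) i∉B i∈W = ∣─toggle∣ W B i i∉B i∈W
∣─toggle∣ (true ∷ W)  (false ∷ B) (suc i) i∉B i∈W = cong suc (∣─toggle∣ W B i i∉B i∈W)
∣─toggle∣ (false ∷ W) (false ∷ B) (suc i) i∉B i∈W = ∣─toggle∣ W B i i∉B i∈W

∣─∣≡0⇒≡ : ∀ {n} (W B : Subset n) → B ⊆ W → ∣ W ─ B ∣ ≡ 0 → W ≡ B
∣─∣≡0⇒≡ []          []          _   _  = refl
∣─∣≡0⇒≡ (w ∷ W)     (true ∷ B)  B⊆W eq with B⊆W here
... | here = cong (true ∷_) (∣─∣≡0⇒≡ W B (SubsetP.drop-∷-⊆ B⊆W) eq)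
∣─∣≡0⇒≡ (false ∷ W) (false ∷ B) B⊆W eq = cong (false ∷_) (∣─∣≡0⇒≡ W B (SubsetP.drop-∷-⊆ B⊆W) eq)

∣p─p∣≡0 : ∀ {n} (W : Subset n) → ∣ W ─ W ∣ ≡ 0
∣p─p∣≡0 []          = refl
∣p─p∣≡0 (true ∷ W)  = ∣p─p∣≡0 W
∣p─p∣≡0 (false ∷ W) = ∣p─p∣≡0 W

∣∁⊥∣≡n : ∀ n → ∣ ∁ (⊥ {n}) ∣ ≡ n
∣∁⊥∣≡n zero    = refl
∣∁⊥∣≡n (suc n) = cong suc (∣∁⊥∣≡n n)

freshCount-! : ∀ {n} k (B : Subset n) → ∣ ∁ B ∣ ≡ k → freshCount k B ≡ + (k !)
freshCount-! {n} zero    B _        = refl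
freshCount-! {n} (suc k) B ∣∁B∣≡1+k = begin
  freshCount (suc k) B
    ≡⟨ ∑fresh-suc k B _ ⟩
  ∑[ i ∈ allFin n ] (if lookup B i then + 0 else freshCount k (B ⊕ ⁅ i ⁆))
    ≡⟨ ∑-cong (allFin n) afterFirst ⟩
  ∑[ i ∈ allFin n ] (if lookup B i then + 0 else + (k !))
    ≡⟨ ∑-allFin-outside B (+ (k !)) ⟩
  + ∣ ∁ B ∣ * + (k !)
    ≡⟨ cong (λ m → + m * + (k !)) ∣∁B∣≡1+k ⟩
  + suc k * + (k !)
    ≡⟨ ℤP.pos-* (suc k) (k !) ⟨
  + (suc k !) ∎
  where
  open ≡-Reasoning
  afterFirst : ∀ i → (if lookup B i then + 0 else freshCount k (B ⊕ ⁅ i ⁆)) ≡ (if lookup B i then + 0 else + (k !))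
  afterFirst i with lookup B i in i∉B
  ... | true  = refl
  ... | false = freshCount-! k (B ⊕ ⁅ i ⁆) (ℕP.suc-injective (trans (sym (∣∁toggle∣ B i i∉B)) ∣∁B∣≡1+k))

module _ {n : ℕ} (a : Fin n) (W : Subset n) where

  flipCount : ℕ → Subset n → ℤ
  flipCount k B = ∑fresh k B (flipSum a 𝟙[ W ] B)

  flipCount-suc : ∀ k B → flipCount (suc k) B ≡ ∑[ i ∈ allFin n ] (if lookup B i then + 0 else
    ((if does (i ≟ a) then 𝟙[ W ] B else + 0) * freshCount k (B ⊕ ⁅ i ⁆) + flipCount k (B ⊕ ⁅ i ⁆)))
  flipCount-suc k B = trans (∑fresh-suc k B _) (∑-cong (allFin n) splitFirst)
    where
    splitFirst : ∀ i → (if lookup B i then + 0 else ∑fresh k (B ⊕ ⁅ i ⁆) (flipSum a 𝟙[ W ] B ∘ (i ∷_)))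
      ≡ (if lookup B i then + 0 else
         ((if does (i ≟ a) then 𝟙[ W ] B else + 0) * freshCount k (B ⊕ ⁅ i ⁆) + flipCount k (B ⊕ ⁅ i ⁆)))
    splitFirst i with lookup B i
    ... | true  = refl
    ... | false = trans (∑fresh-+ k (B ⊕ ⁅ i ⁆) (λ _ → hit) (flipSum a 𝟙[ W ] (B ⊕ ⁅ i ⁆)))
                        (cong (λ x → x + flipCount k (B ⊕ ⁅ i ⁆)) (∑fresh-const k (B ⊕ ⁅ i ⁆) hit))
      where
      hit : ℤ
      hit = if does (i ≟ a) then 𝟙[ W ] B else + 0

  flipCount-unreachable : ∀ k B → ¬ (B ⊆ W × a ∉ W) → flipCount k B ≡ + 0
  flipCount-unreachable zero    B _           = refl
  flipCount-unreachable (suc k) B unreachable =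
    trans (flipCount-suc k B) (trans (∑-cong (allFin n) vanish) (∑-zero (allFin n)))
    where
    noHit : ∀ i → lookup B i ≡ false → (if does (i ≟ a) then 𝟙[ W ] B else + 0) ≡ + 0
    noHit i i∉B with i ≟ a
    ... | no  _    = refl
    ... | yes refl with W ≟S B in W≟B
    ...   | false = refl
    ...   | true  = ⊥-elim (unreachable (B⊆W , subst (i ∉_) (sym W≡B) (lookup≡false⇒∉ i∉B)))
      where
      W≡B : W ≡ B
      W≡B = ≟S-sound W B W≟B
      B⊆W : B ⊆ W
      B⊆W = subst (B ⊆_) (sym W≡B) (λ x → x)
    vanish : ∀ i → (if lookup B i then + 0 else
      ((if does (i ≟ a) then 𝟙[ W ] B else + 0) * freshCount k (B ⊕ ⁅ i ⁆) + flipCount k (B ⊕ ⁅ i ⁆))) ≡ + 0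
    vanish i with lookup B i in i∉B
    ... | true  = refl
    ... | false = cong₂ _+_ (cong (λ c → c * freshCount k (B ⊕ ⁅ i ⁆)) (noHit i i∉B))
      (flipCount-unreachable k (B ⊕ ⁅ i ⁆) λ (B⊕i⊆W , a∉W) → unreachable (B⊕i⊆W ∘ ⊆-toggle B i∉B , a∉W))

  closedForm : Subset n → ℕ
  closedForm B = ∣ W ─ B ∣ ! ℕ.* pred ∣ ∁ W ∣ !

  closedForm-recurrence : ∀ k B → B ⊆ W → ∣ ∁ B ∣ ≡ suc k →
    𝟙[ W ] B * + (k !) + + ∣ W ─ B ∣ * + (pred ∣ W ─ B ∣ ! ℕ.* pred ∣ ∁ W ∣ !) ≡ + closedForm B
  closedForm-recurrence k B B⊆W ∣∁B∣≡1+k with W ≟S B in W≟B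
  ... | true = W≡B-case (trans (cong (λ V → ∣ V ─ B ∣) (≟S-sound W B W≟B)) (∣p─p∣≡0 B))
                        (trans (cong (∣_∣ ∘ ∁) (≟S-sound W B W≟B)) ∣∁B∣≡1+k)
    where
    W≡B-case : ∣ W ─ B ∣ ≡ 0 → ∣ ∁ W ∣ ≡ suc k →
      + 1 * + (k !) + + ∣ W ─ B ∣ * + (pred ∣ W ─ B ∣ ! ℕ.* pred ∣ ∁ W ∣ !) ≡ + closedForm B
    W≡B-case ∣W─B∣≡0 ∣∁W∣≡1+k rewrite ∣W─B∣≡0 | ∣∁W∣≡1+k =
      trans (ℤP.+-identityʳ _) (trans (ℤP.*-identityˡ _) (cong +_ (sym (ℕP.*-identityˡ (k !)))))
  ... | false with ∣ W ─ B ∣ in ∣W─B∣≡d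
  ...   | zero  = ⊥-elim (true≢false (trans (sym (≟S-complete (∣─∣≡0⇒≡ W B B⊆W ∣W─B∣≡d))) W≟B))
  ...   | suc d = trans (ℤP.+-identityˡ _)
    (trans (sym (ℤP.pos-* (suc d) _)) (cong +_ (sym (ℕP.*-assoc (suc d) (d !) (pred ∣ ∁ W ∣ !)))))

  -- The letters of W ─ B come first in any order, then a, then the other letters outside W.
  flipCount-formula : ∀ k B → B ⊆ W → lookup W a ≡ false → ∣ ∁ B ∣ ≡ k → flipCount k B ≡ + closedForm B
  flipCount-formula zero    B B⊆W a∉W ∣∁B∣≡0 =
    ⊥-elim (ℕP.0≢1+n (trans (sym ∣∁B∣≡0) (∣∁toggle∣ B a (∉⇒lookup≡false (lookup≡false⇒∉ a∉W ∘ B⊆W)))))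
  flipCount-formula (suc k) B B⊆W a∉W ∣∁B∣≡1+k = begin
    flipCount (suc k) B
      ≡⟨ flipCount-suc k B ⟩
    ∑[ i ∈ allFin n ] (if lookup B i then + 0 else
      ((if does (i ≟ a) then 𝟙[ W ] B else + 0) * freshCount k (B ⊕ ⁅ i ⁆) + flipCount k (B ⊕ ⁅ i ⁆)))
      ≡⟨ ∑-cong (allFin n) separate ⟩
    ∑[ i ∈ allFin n ] (hitAt i + restAt i)
      ≡⟨ ∑-+ (allFin n) hitAt restAt ⟩
    ∑ (allFin n) hitAt + ∑ (allFin n) restAt
      ≡⟨ cong₂ _+_ (∑-allFin-pick n a _) (∑-allFin-─ W B rest) ⟩
    (if lookup B a then + 0 else 𝟙[ W ] B * + (k !)) + + ∣ W ─ B ∣ * rest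
      ≡⟨ cong (λ b → (if b then + 0 else 𝟙[ W ] B * + (k !)) + + ∣ W ─ B ∣ * rest) a∉B ⟩
    𝟙[ W ] B * + (k !) + + ∣ W ─ B ∣ * rest
      ≡⟨ closedForm-recurrence k B B⊆W ∣∁B∣≡1+k ⟩
    + closedForm B ∎
    where
    open ≡-Reasoning
    a∉B : lookup B a ≡ false
    a∉B = ∉⇒lookup≡false (lookup≡false⇒∉ a∉W ∘ B⊆W)
    rest : ℤ
    rest = + (pred ∣ W ─ B ∣ ! ℕ.* pred ∣ ∁ W ∣ !)
    hitAt restAt : Fin n → ℤ
    hitAt i = if does (i ≟ a) then (if lookup B i then + 0 else 𝟙[ W ] B * + (k !)) else + 0
    restAt i = if lookup B i then + 0 else (if lookup W i then rest else + 0)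
    separate : ∀ i → (if lookup B i then + 0 else
      ((if does (i ≟ a) then 𝟙[ W ] B else + 0) * freshCount k (B ⊕ ⁅ i ⁆) + flipCount k (B ⊕ ⁅ i ⁆)))
      ≡ hitAt i + restAt i
    separate i with lookup B i in i∉B
    ... | true with does (i ≟ a)
    ...   | true  = refl
    ...   | false = refl
    separate i | false = cong₂ _+_ hitTerm restTerm
      where
      ∣∁B⊕i∣≡k : ∣ ∁ (B ⊕ ⁅ i ⁆) ∣ ≡ k
      ∣∁B⊕i∣≡k = ℕP.suc-injective (trans (sym (∣∁toggle∣ B i i∉B)) ∣∁B∣≡1+k)
      hitTerm : (if does (i ≟ a) then 𝟙[ W ] B else + 0) * freshCount k (B ⊕ ⁅ i ⁆)
        ≡ (if does (i ≟ a) then 𝟙[ W ] B * + (k !) else + 0)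
      hitTerm rewrite freshCount-! k (B ⊕ ⁅ i ⁆) ∣∁B⊕i∣≡k with does (i ≟ a)
      ... | true  = refl
      ... | false = refl
      restTerm : flipCount k (B ⊕ ⁅ i ⁆) ≡ (if lookup W i then rest else + 0)
      restTerm with lookup W i in i∈W
      ... | true  = trans (flipCount-formula k (B ⊕ ⁅ i ⁆) (toggle-⊆ i∉B B⊆W (VecP.lookup⇒[]= i W i∈W)) a∉W ∣∁B⊕i∣≡k)
        (cong (λ d → + (d ! ℕ.* pred ∣ ∁ W ∣ !)) (cong pred (sym (∣─toggle∣ W B i i∉B i∈W))))
      ... | false = flipCount-unreachable k (B ⊕ ⁅ i ⁆) λ (B⊕i⊆W , _) →
        lookup≡false⇒∉ i∈W (B⊕i⊆W (VecP.lookup⇒[]= i (B ⊕ ⁅ i ⁆) (lookup-toggle-self B i i∉B)))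

prefixCount-∈ : ∀ {n} (a : Fin n) (W : Subset n) → a ∈ W → prefixCount a W ≡ + 0
prefixCount-∈ {n} a W a∈W =
  trans (prefixCount≡∑fresh a W) (flipCount-unreachable a W n ⊥ (λ (_ , a∉W) → a∉W a∈W))

prefixCount-∉ : ∀ {n} (a : Fin n) (W : Subset n) → a ∉ W → prefixCount a W ≡ + (∣ W ∣ ! ℕ.* pred ∣ ∁ W ∣ !)
prefixCount-∉ {n} a W a∉W = begin
  prefixCount a W
    ≡⟨ prefixCount≡∑fresh a W ⟩
  flipCount a W n ⊥
    ≡⟨ flipCount-formula a W n ⊥ SubsetP.⊥⊆ (∉⇒lookup≡false a∉W) (∣∁⊥∣≡n n) ⟩
  + (∣ W ─ ⊥ ∣ ! ℕ.* pred ∣ ∁ W ∣ !)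
    ≡⟨ cong (λ V → + (∣ V ∣ ! ℕ.* pred ∣ ∁ W ∣ !)) (SubsetP.p─⊥≡p W) ⟩
  + (∣ W ∣ ! ℕ.* pred ∣ ∁ W ∣ !) ∎
  where open ≡-Reasoning

-- Factorials and balanced subsets

!*!-shift : ∀ j r → r ≤ j → j ! ℕ.* suc r ! ≤ suc j ! ℕ.* r !
!*!-shift j r r≤j = begin
  j ! ℕ.* (suc r ℕ.* r !)   ≡⟨ regroup (j !) (r !) (suc r) ⟩
  (j ! ℕ.* r !) ℕ.* suc r   ≤⟨ ℕP.*-monoʳ-≤ (j ! ℕ.* r !) (ℕ.s≤s r≤j) ⟩
  (j ! ℕ.* r !) ℕ.* suc j   ≡⟨ regroup′ (j !) (r !) (suc j) ⟩
  (suc j ℕ.* j !) ℕ.* r !   ∎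
  where
  open ℕP.≤-Reasoning
  regroup : ∀ x y w → x ℕ.* (w ℕ.* y) ≡ (x ℕ.* y) ℕ.* w
  regroup = ℕSolver.solve-∀
  regroup′ : ∀ x y w → (x ℕ.* y) ℕ.* w ≡ (w ℕ.* x) ℕ.* y
  regroup′ = ℕSolver.solve-∀

!*!-spread : ∀ d s t → t ℕ.+ d ≤ suc s → s ! ℕ.* (t ℕ.+ d) ! ≤ (s ℕ.+ d) ! ℕ.* t !
!*!-spread zero    s t _ rewrite ℕP.+-identityʳ t | ℕP.+-identityʳ s = ℕP.≤-refl
!*!-spread (suc d) s t t+d<2+s = begin
  s ! ℕ.* (t ℕ.+ suc d) !     ≡⟨ cong (λ x → s ! ℕ.* x !) (ℕP.+-suc t d) ⟩
  s ! ℕ.* (suc t ℕ.+ d) !     ≤⟨ !*!-spread d s (suc t) (subst (_≤ suc s) (ℕP.+-suc t d) t+d<2+s) ⟩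
  (s ℕ.+ d) ! ℕ.* suc t !     ≤⟨ !*!-shift (s ℕ.+ d) t t≤s+d ⟩
  suc (s ℕ.+ d) ! ℕ.* t !     ≡⟨ cong (λ x → x ! ℕ.* t !) (ℕP.+-suc s d) ⟨
  (s ℕ.+ suc d) ! ℕ.* t !     ∎
  where
  open ℕP.≤-Reasoning
  t≤s+d : t ≤ s ℕ.+ d
  t≤s+d = ℕP.≤-trans (ℕP.m≤m+n t d)
    (ℕP.≤-trans (ℕP.≤-pred (subst (_≤ suc s) (ℕP.+-suc t d) t+d<2+s)) (ℕP.m≤m+n s d))

+-transfer : ∀ s t t′ d → s ℕ.+ t ≡ (s ℕ.+ d) ℕ.+ t′ → t ≡ t′ ℕ.+ d
+-transfer s t t′ d eq = trans (ℕP.+-cancelˡ-≡ s t (d ℕ.+ t′) (trans eq (ℕP.+-assoc s d t′))) (ℕP.+-comm d t′)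

!*!-balanced-minimal : ∀ s t s′ t′ → s ℕ.+ t ≡ s′ ℕ.+ t′ → s ≤ suc t → t ≤ suc s → s ! ℕ.* t ! ≤ s′ ! ℕ.* t′ !
!*!-balanced-minimal s t s′ t′ eq s≤1+t t≤1+s with ℕP.≤-total s s′
... | inj₁ s≤s′ with ℕP.m≤n⇒∃[o]m+o≡n s≤s′
...   | d , refl = subst (λ u → s ! ℕ.* u ! ≤ (s ℕ.+ d) ! ℕ.* t′ !) (sym t≡t′+d)
  (!*!-spread d s t′ (subst (_≤ suc s) t≡t′+d t≤1+s))
  where
  t≡t′+d : t ≡ t′ ℕ.+ d
  t≡t′+d = +-transfer s t t′ d eq
!*!-balanced-minimal s t s′ t′ eq s≤1+t t≤1+s | inj₂ s′≤s with ℕP.m≤n⇒∃[o]m+o≡n s′≤s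
...   | d , refl = subst (λ u → (s′ ℕ.+ d) ! ℕ.* t ! ≤ s′ ! ℕ.* u !) (sym t′≡t+d)
  (subst₂ _≤_ (ℕP.*-comm (t !) _) (ℕP.*-comm ((t ℕ.+ d) !) _) (!*!-spread d t s′ s≤1+t))
  where
  t′≡t+d : t′ ≡ t ℕ.+ d
  t′≡t+d = +-transfer s′ t′ t d (sym eq)

halves⇒balanced : ∀ {n} s t → s ℕ.+ suc t ≡ n → n ≤ 2 ℕ.* suc t → n ≤ 2 ℕ.* suc s → s ≤ suc t × t ≤ suc s
halves⇒balanced {n} s t size n≤2+2t n≤2+2s =
  ℕP.+-cancelʳ-≤ (suc t) s (suc t) (subst₂ _≤_ (sym size) (double (suc t)) n≤2+2t) ,
  ℕP.≤-pred (ℕP.+-cancelˡ-≤ s (suc t) (suc (suc s)) (subst₂ _≤_ (sym size) (double′ s) n≤2+2s))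
  where
  double : ∀ m → 2 ℕ.* m ≡ m ℕ.+ m
  double = ℕSolver.solve-∀
  double′ : ∀ m → 2 ℕ.* suc m ≡ m ℕ.+ suc (suc m)
  double′ = ℕSolver.solve-∀

∣p∣+∣∁p∣≡n : ∀ {n} (p : Subset n) → ∣ p ∣ ℕ.+ ∣ ∁ p ∣ ≡ n
∣p∣+∣∁p∣≡n []          = refl
∣p∣+∣∁p∣≡n (true ∷ p)  = cong suc (∣p∣+∣∁p∣≡n p)
∣p∣+∣∁p∣≡n (false ∷ p) = trans (ℕP.+-suc ∣ p ∣ ∣ ∁ p ∣) (cong suc (∣p∣+∣∁p∣≡n p))

∣toggle∣ : ∀ {n} (B : Subset n) (i : Fin n) → lookup B i ≡ false → ∣ B ⊕ ⁅ i ⁆ ∣ ≡ suc ∣ B ∣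
∣toggle∣ (false ∷ B) zero    _   rewrite ⊕-identityʳ B = refl
∣toggle∣ (true ∷ B)  (suc i) i∉B = cong suc (∣toggle∣ B i i∉B)
∣toggle∣ (false ∷ B) (suc i) i∉B = ∣toggle∣ B i i∉B

∣p∣+suc∣∁toggle∣≡n : ∀ {n} (a : Fin n) (V : Subset n) → lookup V a ≡ false → ∣ V ∣ ℕ.+ suc ∣ ∁ (V ⊕ ⁅ a ⁆) ∣ ≡ n
∣p∣+suc∣∁toggle∣≡n a V a∉V = trans (cong (∣ V ∣ ℕ.+_) (sym (∣∁toggle∣ V a a∉V))) (∣p∣+∣∁p∣≡n V)

prefixCount-minimal : ∀ {n} (a : Fin n) (W V : Subset n) → lookup W a ≡ false → lookup V a ≡ false →
  n ≤ 2 ℕ.* ∣ ∁ W ∣ → n ≤ 2 ℕ.* ∣ W ⊕ ⁅ a ⁆ ∣ → prefixCount a W ℤ.≤ prefixCount a V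
prefixCount-minimal {n} a W V a∉W a∉V n≤2∣∁W∣ n≤2∣W⊕a∣
  rewrite prefixCount-∉ a W (lookup≡false⇒∉ a∉W) | prefixCount-∉ a V (lookup≡false⇒∉ a∉V)
        | cong pred (∣∁toggle∣ W a a∉W) | cong pred (∣∁toggle∣ V a a∉V) =
  ℤ.+≤+ (!*!-balanced-minimal s t (∣ V ∣) (∣ ∁ (V ⊕ ⁅ a ⁆) ∣) sameTotal (proj₁ balanced) (proj₂ balanced))
  where
  s t : ℕ
  s = ∣ W ∣
  t = ∣ ∁ (W ⊕ ⁅ a ⁆) ∣
  sameTotal : s ℕ.+ t ≡ ∣ V ∣ ℕ.+ ∣ ∁ (V ⊕ ⁅ a ⁆) ∣
  sameTotal = ℕP.suc-injective (trans (sym (ℕP.+-suc s t))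
    (trans (trans (∣p∣+suc∣∁toggle∣≡n a W a∉W) (sym (∣p∣+suc∣∁toggle∣≡n a V a∉V))) (ℕP.+-suc ∣ V ∣ _)))
  balanced : s ≤ suc t × t ≤ suc s
  balanced = halves⇒balanced s t (∣p∣+suc∣∁toggle∣≡n a W a∉W)
    (subst (λ m → n ≤ 2 ℕ.* m) (∣∁toggle∣ W a a∉W) n≤2∣∁W∣)
    (subst (λ m → n ≤ 2 ℕ.* m) (∣toggle∣ W a a∉W) n≤2∣W⊕a∣)

-- Maximal intersecting families

module _ {n : ℕ} {𝓕 : Family n} (maximal : MaximalIntersecting 𝓕) where

  maximal-extend : ∀ B → Nonempty B → (∀ X → X ∈F 𝓕 → Nonempty (B ∩ X)) → B ∈F 𝓕
  maximal-extend B (x , x∈B) meetsB = proj₂ maximal 𝓖 𝓖-intersecting 𝓕⊆𝓖 B B∈𝓖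
    where
    𝓖 : Family n
    𝓖 X = 𝓕 X ∨ (X ≟S B)
    member : ∀ X → X ∈F 𝓖 → X ∈F 𝓕 ⊎ X ≡ B
    member X X∈𝓖 with 𝓕 X
    ... | true  = inj₁ refl
    ... | false = inj₂ (≟S-sound X B X∈𝓖)
    𝓖-intersecting : Intersecting 𝓖
    𝓖-intersecting X Y X∈𝓖 Y∈𝓖 with member X X∈𝓖 | member Y Y∈𝓖
    ... | inj₁ X∈𝓕 | inj₁ Y∈𝓕 = proj₁ maximal X Y X∈𝓕 Y∈𝓕
    ... | inj₂ refl | inj₁ Y∈𝓕 = meetsB Y Y∈𝓕
    ... | inj₁ X∈𝓕 | inj₂ refl = subst Nonempty (SubsetP.∩-comm B X) (meetsB X X∈𝓕)
    ... | inj₂ refl | inj₂ refl = x , subst (x ∈_) (sym (SubsetP.∩-idem B)) x∈B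
    𝓕⊆𝓖 : ∀ A → A ∈F 𝓕 → A ∈F 𝓖
    𝓕⊆𝓖 A A∈𝓕 rewrite A∈𝓕 = refl
    B∈𝓖 : B ∈F 𝓖
    B∈𝓖 rewrite ≟S-complete {X = B} refl = BoolP.∨-zeroʳ (𝓕 B)

  maximal-upward : ∀ {A B} → A ∈F 𝓕 → A ⊆ B → B ∈F 𝓕
  maximal-upward {A} {B} A∈𝓕 A⊆B = maximal-extend B (x , A⊆B (proj₁ (SubsetP.x∈p∩q⁻ A A x∈A∩A))) meetsB
    where
    x = proj₁ (proj₁ maximal A A A∈𝓕 A∈𝓕)
    x∈A∩A = proj₂ (proj₁ maximal A A A∈𝓕 A∈𝓕)
    meetsB : ∀ X → X ∈F 𝓕 → Nonempty (B ∩ X)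
    meetsB X X∈𝓕 with proj₁ maximal A X A∈𝓕 X∈𝓕
    ... | y , y∈A∩X with SubsetP.x∈p∩q⁻ A X y∈A∩X
    ...   | y∈A , y∈X = y , SubsetP.x∈p∩q⁺ (A⊆B y∈A , y∈X)

  maximal-complement : ∀ B → 𝓕 B ≡ false → Nonempty (∁ B) → ∁ B ∈F 𝓕
  maximal-complement B B∉𝓕 nonempty = maximal-extend (∁ B) nonempty meets∁B
    where
    meets∁B : ∀ X → X ∈F 𝓕 → Nonempty (∁ B ∩ X)
    meets∁B X X∈𝓕 with SubsetP.nonempty? (∁ B ∩ X)
    ... | yes meets = meets
    ... | no  disjoint = ⊥-elim (true≢false (trans (sym (maximal-upward X∈𝓕 X⊆B)) B∉𝓕))
      where
      X⊆B : X ⊆ B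
      X⊆B {x} x∈X = SubsetP.x∉∁p⇒x∈p (λ x∈∁B → disjoint (x , SubsetP.x∈p∩q⁺ (x∈∁B , x∈X)))

module _ {n : ℕ} {𝓕 : Family n} (maximal : MaximalIntersecting 𝓕) (central : Central 𝓕) (a : Fin n) where

  ∂⋆-prefixCount-≤ : ∀ A → lookup A a ≡ false → ∀ W →
    ∂ (𝓕 ⋆) a W * prefixCount a W ℤ.≤ ∂ (𝓕 ⋆) a W * prefixCount a (W ⊕ A)
  ∂⋆-prefixCount-≤ A a∉A W with lookup W a in a∈?W
  ... | true  = subst₂ (λ x y → ∂ (𝓕 ⋆) a W * x ℤ.≤ ∂ (𝓕 ⋆) a W * y)
    (sym (prefixCount-∈ a W (VecP.lookup⇒[]= a W a∈?W)))
    (sym (prefixCount-∈ a (W ⊕ A) (VecP.lookup⇒[]= a (W ⊕ A) a∈W⊕A)))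
    ℤP.≤-refl
    where
    a∈W⊕A : lookup (W ⊕ A) a ≡ true
    a∈W⊕A = trans (lookup-⊕ W A a) (cong₂ _xor_ a∈?W a∉A)
  ... | false with 𝓕 (∁ W) in ∁W∈? | 𝓕 (∁ (W ⊕ ⁅ a ⁆)) in ∁W⊕a∈?
  ...   | true  | true  = ℤP.≤-refl
  ...   | false | false = ℤP.≤-refl
  ...   | false | true  = ⊥-elim (true≢false (trans (sym (maximal-upward maximal ∁W⊕a∈? ∁W⊕a⊆∁W)) ∁W∈?))
    where
    ∁W⊕a⊆∁W : ∁ (W ⊕ ⁅ a ⁆) ⊆ ∁ W
    ∁W⊕a⊆∁W = SubsetP.p⊆q⇒∁p⊇∁q (⊆-toggle W a∈?W)
  ...   | true  | false = subst₂ ℤ._≤_ (sym (ℤP.*-identityˡ _)) (sym (ℤP.*-identityˡ _))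
    (prefixCount-minimal a W (W ⊕ A) a∈?W a∉W⊕A (central (∁ W) ∁W∈?) (central (W ⊕ ⁅ a ⁆) W⊕a∈𝓕))
    where
    a∉W⊕A : lookup (W ⊕ A) a ≡ false
    a∉W⊕A = trans (lookup-⊕ W A a) (cong₂ _xor_ a∈?W a∉A)
    a∈∁∁W⊕a : a ∈ ∁ (∁ (W ⊕ ⁅ a ⁆))
    a∈∁∁W⊕a = subst (a ∈_) (sym (∁-involutive (W ⊕ ⁅ a ⁆)))
      (VecP.lookup⇒[]= a (W ⊕ ⁅ a ⁆) (lookup-toggle-self W a a∈?W))
    W⊕a∈𝓕 : (W ⊕ ⁅ a ⁆) ∈F 𝓕
    W⊕a∈𝓕 = subst (_∈F 𝓕) (∁-involutive (W ⊕ ⁅ a ⁆))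
      (maximal-complement maximal (∁ (W ⊕ ⁅ a ⁆)) ∁W⊕a∈? (a , a∈∁∁W⊕a))

mainTheorem7 : (n : ℕ) (𝓕 : Family n) →
    MaximalIntersecting 𝓕 → Central 𝓕 → EmptyMinimal 𝓕
mainTheorem7 n 𝓕 maximal central a A a∉A = begin
  Λ (𝓕 ⋆) ⊥ ⁅ a ⁆
    ≡⟨ cong (Λ (𝓕 ⋆) ⊥) (⊕-identityˡ ⁅ a ⁆) ⟨
  Λ (𝓕 ⋆) ⊥ (⊥ ⊕ ⁅ a ⁆)
    ≡⟨ Λ-edge (𝓕 ⋆) ⊥ a ⟩
  ∑[ W ∈ allSubsets n ] (∂ (𝓕 ⋆) a W * prefixCount a (W ⊕ ⊥))
    ≡⟨ ∑-cong (allSubsets n) (λ W → cong (λ V → ∂ (𝓕 ⋆) a W * prefixCount a V) (⊕-identityʳ W)) ⟩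
  ∑[ W ∈ allSubsets n ] (∂ (𝓕 ⋆) a W * prefixCount a W)
    ≤⟨ ∑-mono-≤ (allSubsets n) (∂⋆-prefixCount-≤ maximal central a A (∉⇒lookup≡false a∉A)) ⟩
  ∑[ W ∈ allSubsets n ] (∂ (𝓕 ⋆) a W * prefixCount a (W ⊕ A))
    ≡⟨ Λ-edge (𝓕 ⋆) A a ⟨
  Λ (𝓕 ⋆) A (A ⊕ ⁅ a ⁆)
    ≡⟨ cong (Λ (𝓕 ⋆) A) (toggle≡∪ A a (∉⇒lookup≡false a∉A)) ⟩
  Λ (𝓕 ⋆) A (A ∪ ⁅ a ⁆) ∎
  where
  open ℤP.≤-Reasoning
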